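{- Let $t$ be a positive integer and $Q_t=\{1,3,5,\dots,2t-1\}\setminus\{t,t+1\}$. A self-conjugate partition $\lambda$ belongs to $\mathcal{DS}(t)$ if and only if $MD(\lambda)$ satisfies all of the following: (i) $MD(\lambda)\subseteq Q_t$; (ii) if $h_1,h_2\in MD(\lambda)$ and $h_1>h_2$, then $h_1-h_2\ge4$; (iii) if $h_1,h_2\in MD(\lambda)$, then $h_1+h_2\ne 2t$ and $h_1+h_2\ne 2t+2$.
   Context: Hook length of box $(i,j)$ of a Young diagram: number of boxes to its right in row $i$, plus number below it in column $j$, plus one. A partition is a $t$-core if no hook length is divisible by $t$; a $(t,t+1)$-core if it is both a $t$-core and a $(t+1)$-core. Self-conjugate: Young diagram symmetric about the main diagonal. $s(\lambda)$ is the largest $s$ such that $\lambda$ has at least $s$ parts $\ge s$. $MD(\lambda)$ is the set of hook lengths of the main-diagonal boxes $(i,i)$, $1\le i\le s(\lambda)$ ($MD(\emptyset)=\emptyset$). $\mathcal{DS}(t)$ is the set of self-conjugate $(t,t+1)$-core partitions whose first $s(\lambda)$ parts are pairwise distinct, including the empty partition. -}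

module Defs where

open import Data.Nat using (ℕ; zero; suc; _+_; _*_; _∸_; _≤_; _<_; _≤?_; _<?_)
open import Data.Nat.Divisibility using (_∣_)
open import Data.List using (List; []; _∷_; length; filter; map; upTo)
open import Data.List.Relation.Unary.All using (All)
open import Data.List.Relation.Unary.Linked using (Linked)
open import Data.List.Membership.Propositional using (_∈_)
open import Data.Product using (_×_; ∃-syntax)
open import Data.Bool using (if_then_else_)
open import Relation.Nullary using (¬_)
open import Relation.Nullary.Decidable using (does)
open import Relation.Binary.PropositionalEquality using (_≡_; _≢_)
open import Function.Bundles using (_⇔_)

IsPartition : List ℕ → Set
IsPartition λ′ = Linked (λ a b → b ≤ a) λ′ × All (λ x → 0 < x) λ′

-- part λ i = λ_{i+1} (0-indexed rows), 0 beyond the length.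
part : List ℕ → ℕ → ℕ
part []       _       = 0
part (x ∷ xs) zero    = x
part (x ∷ xs) (suc i) = part xs i

InDiagram : List ℕ → ℕ → ℕ → Set
InDiagram λ′ i j = j < part λ′ i

colLen : List ℕ → ℕ → ℕ
colLen λ′ j = length (filter (j <?_) λ′)

hook : List ℕ → ℕ → ℕ → ℕ
hook λ′ i j = (part λ′ i ∸ suc j) + (colLen λ′ j ∸ suc i) + 1

IsCore : ℕ → List ℕ → Set
IsCore t λ′ = ∀ i j → InDiagram λ′ i j → ¬ (t ∣ hook λ′ i j)

SelfConjugate : List ℕ → Set
SelfConjugate λ′ = ∀ i j → InDiagram λ′ i j ⇔ InDiagram λ′ j i

partsGE : List ℕ → ℕ → ℕ
partsGE λ′ s = length (filter (s ≤?_) λ′)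

durfeeAux : List ℕ → ℕ → ℕ
durfeeAux λ′ zero    = 0
durfeeAux λ′ (suc s) = if does (suc s ≤? partsGE λ′ (suc s)) then suc s else durfeeAux λ′ s

-- s(λ): the largest s such that λ has at least s parts ≥ s
-- (s cannot exceed the number of parts).
sOf : List ℕ → ℕ
sOf λ′ = durfeeAux λ′ (length λ′)

MD : List ℕ → List ℕ
MD λ′ = map (λ i → hook λ′ i i) (upTo (sOf λ′))

FirstPartsDistinct : List ℕ → Set
FirstPartsDistinct λ′ = ∀ i j → i < j → j < sOf λ′ → part λ′ i ≢ part λ′ j

InDS : ℕ → List ℕ → Set
InDS t λ′ = IsPartition λ′ × SelfConjugate λ′ × IsCore t λ′ × IsCore (suc t) λ′
          × FirstPartsDistinct λ′

InQ : ℕ → ℕ → Set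
InQ t h = (∃[ k ] (k < t × h ≡ 2 * k + 1)) × h ≢ t × h ≢ suc t

CondI : ℕ → List ℕ → Set
CondI t λ′ = ∀ h → h ∈ MD λ′ → InQ t h

CondII : List ℕ → Set
CondII λ′ = ∀ h₁ h₂ → h₁ ∈ MD λ′ → h₂ ∈ MD λ′ → h₂ < h₁ → 4 ≤ h₁ ∸ h₂

CondIII : ℕ → List ℕ → Set
CondIII t λ′ = ∀ h₁ h₂ → h₁ ∈ MD λ′ → h₂ ∈ MD λ′ →
               h₁ + h₂ ≢ 2 * t × h₁ + h₂ ≢ 2 * t + 2

-- Write p i for the (i+1)-st part. Self-conjugacy makes column lengths equal to parts, so box
-- (i, j) has hook p i + p j ∸ suc (i + j): the diagonal hooks are 2aᵢ + 1 for the Frobenius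
-- coordinates aᵢ = p i ∸ suc i, and inside the Durfee square the hook of (i, j) is the average of
-- those of (i, i) and (j, j). Distinct first parts mean that aᵢ drops by at least 2 along the
-- diagonal, which is (ii). Scanning the first row, every n < p 0 is either a Frobenius coordinate
-- or p 0 ∸ suc n is a first-row hook. For a (t, t+1)-core, n = p 0 ∸ suc t and n = p 0 ∸ 2 ∸ t
-- then give hooks t, t+1, two Frobenius coordinates at distance 1, or (when p 0 = t+1) diagonal
-- hooks 1 and 2t+1 violating (iii); so p 0 ≤ t, which is (i), and (iii) is the averaging applied
-- to hooks t and t+1. Conversely (i) gives p i ≤ t + i on the diagonal, so every hook is below 2t,
-- and below t outside the Durfee square; with (iii) no hook is t or t+1, and a positive hook
-- below 2d that d divides equals d.

module Submission where

open import Defs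
open import Data.Nat using (ℕ; zero; suc; _+_; _*_; _∸_; _≤_; _<_; z≤n; s≤s; z<s; s≤s⁻¹; _≤?_; _<?_)
open import Data.Nat.Properties
open import Algebra.Properties.CommutativeSemigroup +-commutativeSemigroup
  using () renaming (interchange to +-interchange)
open import Data.Nat.Divisibility using (_∣_; divides; ∣-reflexive)
open import Data.Nat.Tactic.RingSolver using (solve-∀)
open import Data.Bool using (if_then_else_)
open import Data.List using (List; []; _∷_; length)
open import Data.List.Properties using (filter-accept; filter-reject)
open import Data.List.Membership.Propositional using (_∈_)
open import Data.List.Membership.Propositional.Properties using (∈-map⁺; ∈-map⁻; ∈-upTo⁺; ∈-upTo⁻)
open import Data.Product using (_×_; _,_; proj₁; proj₂; ∃-syntax)
open import Data.Sum using (_⊎_; inj₁; inj₂; [_,_]′)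
open import Function using (_∘_)
open import Function.Bundles using (_⇔_; mk⇔; Equivalence)
open import Relation.Binary using (tri<; tri≈; tri>)
open import Relation.Nullary using (¬_; yes; no; does; contradiction)
open import Relation.Nullary.Decidable using (dec-true; dec-false)
open import Relation.Unary using (Decidable)
open import Relation.Binary.PropositionalEquality
open Equivalence using (to; from)
open ≤-Reasoning

boundary : ∀ {P : ℕ → Set} → Decidable P → P 0 → ∀ n → ¬ P n → ∃[ j ] P j × ¬ P (suc j)
boundary P? P₀ zero    ¬Pₙ = contradiction P₀ ¬Pₙ
boundary P? P₀ (suc n) ¬P₁₊ₙ with P? n
... | yes Pₙ  = n , Pₙ , ¬P₁₊ₙ
... | no  ¬Pₙ = boundary P? P₀ n ¬Pₙ

m+m≡2*n⇒m≡n : ∀ {m n} → m + m ≡ 2 * n → m ≡ n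
m+m≡2*n⇒m≡n {m} {n} eq = *-cancelˡ-≡ m n 2 (trans (cong (m +_) (+-identityʳ m)) eq)

suc-double-shift : ∀ h i → h + suc (suc i + suc i) ≡ 2 + h + suc (i + i)
suc-double-shift = solve-∀

∣∧<double⇒≡ : ∀ {d h} → 0 < h → h < d + d → d ∣ h → h ≡ d
∣∧<double⇒≡ 0<h h<2d (divides zero h≡0) = contradiction h≡0 (≢-sym (<⇒≢ 0<h))
∣∧<double⇒≡ {d} 0<h h<2d (divides 1 h≡d) = trans h≡d (+-identityʳ d)
∣∧<double⇒≡ {d} 0<h h<2d (divides (suc (suc q)) h≡) =
  contradiction (subst (d + d ≤_) (sym h≡) (+-monoʳ-≤ d (m≤m+n d (q * d)))) (<⇒≱ h<2d)

colLen-≡ : ∀ L j m → (∀ k → j < part L k ⇔ k < m) → colLen L j ≡ m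
colLen-≡ []       j zero    rows = refl
colLen-≡ []       j (suc m) rows = contradiction (from (rows 0) z<s) λ ()
colLen-≡ (x ∷ xs) j zero    rows =
  trans (cong length (filter-reject (j <?_) (λ j<x → contradiction (to (rows 0) j<x) λ ())))
        (colLen-≡ xs j zero λ k → mk⇔ (λ j<xₖ → contradiction (to (rows (suc k)) j<xₖ) λ ()) λ ())
colLen-≡ (x ∷ xs) j (suc m) rows =
  trans (cong length (filter-accept (j <?_) (from (rows 0) z<s)))
        (cong suc (colLen-≡ xs j m λ k → mk⇔ (s≤s⁻¹ ∘ to (rows (suc k))) (from (rows (suc k)) ∘ s≤s)))

0<part⇒<length : ∀ L i → 0 < part L i → i < length L
0<part⇒<length (x ∷ L) zero    _    = z<s
0<part⇒<length (x ∷ L) (suc i) 0<xᵢ = s≤s (0<part⇒<length L i 0<xᵢ)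

core⇒hook≢ : ∀ {d} L → IsCore d L → ∀ {i j} → InDiagram L i j → hook L i j ≢ d
core⇒hook≢ L core b h≡d = core _ _ b (∣-reflexive (sym h≡d))

small-hooks⇒core : ∀ {d} L → (∀ {i j} → InDiagram L i j → hook L i j < d + d) →
                   (∀ {i j} → InDiagram L i j → hook L i j ≢ d) → IsCore d L
small-hooks⇒core L below ≢d i j b d∣h = ≢d b (∣∧<double⇒≡ (m≤n+m 1 _) (below b) d∣h)

condII⇒¬2+h∈MD : ∀ L {h} → CondII L → h ∈ MD L → ¬ 2 + h ∈ MD L
condII⇒¬2+h∈MD L {h} condII h∈ 2+h∈ =
  contradiction (subst (4 ≤_) (m+n∸n≡m 2 h) (condII _ _ 2+h∈ h∈ (m<n+m h z<s))) λ { (s≤s (s≤s ())) }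

module SelfConjugateDiagram (L : List ℕ) (sc : SelfConjugate L) where

  p : ℕ → ℕ
  p = part L

  transpose : ∀ {i j} → j < p i → i < p j
  transpose {i} {j} = to (sc i j)

  colLen≡part : ∀ j → colLen L j ≡ p j
  colLen≡part j = colLen-≡ L j (p j) λ k → sc k j

  part-antitone : ∀ {i k} → i ≤ k → p k ≤ p i
  part-antitone {i} {k} i≤k with p k in pₖ≡
  ... | zero  = z≤n
  ... | suc q = transpose (≤-<-trans i≤k (transpose (≤-reflexive (sym pₖ≡))))

  durfeeAux-suc : ∀ n → durfeeAux L (suc n) ≡ (if does (n <? p n) then suc n else durfeeAux L n)
  durfeeAux-suc n = cong (λ m → if does (suc n ≤? m) then suc n else durfeeAux L n) (colLen≡part n)

  durfeeAux-diagonal : ∀ {n} → n < p n → durfeeAux L (suc n) ≡ suc n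
  durfeeAux-diagonal {n} n<pₙ =
    trans (durfeeAux-suc n) (cong (if_then suc n else durfeeAux L n) (dec-true (n <? p n) n<pₙ))

  durfeeAux-off-diagonal : ∀ {n} → ¬ n < p n → durfeeAux L (suc n) ≡ durfeeAux L n
  durfeeAux-off-diagonal {n} n≮pₙ =
    trans (durfeeAux-suc n) (cong (if_then suc n else durfeeAux L n) (dec-false (n <? p n) n≮pₙ))

  <durfeeAux⇔ : ∀ n {i} → i < durfeeAux L n ⇔ (i < n × i < p i)
  <durfeeAux⇔ zero = mk⇔ (λ ()) (λ ())
  <durfeeAux⇔ (suc n) {i} with n <? p n
  ... | yes n<pₙ rewrite durfeeAux-diagonal n<pₙ =
    mk⇔ (λ i<1+n → i<1+n , diagonal (s≤s⁻¹ i<1+n)) proj₁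
    where
    diagonal : i ≤ n → i < p i
    diagonal i≤n = ≤-<-trans i≤n (<-≤-trans n<pₙ (part-antitone i≤n))
  ... | no n≮pₙ rewrite durfeeAux-off-diagonal n≮pₙ =
    mk⇔ (λ i<d → let i<n , dᵢ = to (<durfeeAux⇔ n) i<d in m<n⇒m<1+n i<n , dᵢ)
        (λ (i<1+n , dᵢ) → from (<durfeeAux⇔ n) (≤∧≢⇒< (s≤s⁻¹ i<1+n) (i≢n dᵢ) , dᵢ))
    where
    i≢n : i < p i → i ≢ n
    i≢n dᵢ refl = n≮pₙ dᵢ

  <sOf⇔ : ∀ {i} → i < sOf L ⇔ i < p i
  <sOf⇔ {i} = mk⇔ (proj₂ ∘ to (<durfeeAux⇔ (length L)))
                  (λ dᵢ → from (<durfeeAux⇔ (length L)) (0<part⇒<length L i (≤-<-trans z≤n dᵢ) , dᵢ))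

  ∈MD⁻ : ∀ {h} → h ∈ MD L → ∃[ i ] i < p i × h ≡ hook L i i
  ∈MD⁻ h∈ with ∈-map⁻ (λ i → hook L i i) h∈
  ... | i , i∈ , h≡ = i , to <sOf⇔ (∈-upTo⁻ i∈) , h≡

  ∈MD⁺ : ∀ {i} → i < p i → hook L i i ∈ MD L
  ∈MD⁺ dᵢ = ∈-map⁺ (λ i → hook L i i) (∈-upTo⁺ (from <sOf⇔ dᵢ))

  hook-formula : ∀ {i j} → j < p i → hook L i j + suc (i + j) ≡ p i + p j
  hook-formula {i} {j} j<pᵢ = begin-equality
    hook L i j + suc (i + j)                         ≡⟨ cong (λ c → a + (c ∸ suc i) + 1 + suc (i + j)) (colLen≡part j) ⟩
    a + l + 1 + suc (i + j)                          ≡⟨ regroup a l i j ⟩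
    (a + suc j) + (l + suc i)                        ≡⟨ cong₂ _+_ (m∸n+n≡m j<pᵢ) (m∸n+n≡m (transpose j<pᵢ)) ⟩
    p i + p j                                        ∎
    where
    a l : ℕ
    a = p i ∸ suc j
    l = p j ∸ suc i
    regroup : ∀ a l i j → a + l + 1 + suc (i + j) ≡ (a + suc j) + (l + suc i)
    regroup = solve-∀

  frobenius : ℕ → ℕ
  frobenius i = p i ∸ suc i

  hook-diagonal : ∀ {i} → i < p i → hook L i i ≡ 2 * frobenius i + 1
  hook-diagonal {i} dᵢ = +-cancelʳ-≡ (suc (i + i)) _ _ (begin-equality
    hook L i i + suc (i + i)                 ≡⟨ hook-formula dᵢ ⟩
    p i + p i                                ≡⟨ sym (cong₂ _+_ (m∸n+n≡m dᵢ) (m∸n+n≡m dᵢ)) ⟩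
    (f + suc i) + (f + suc i)                ≡⟨ regroup f i ⟩
    (2 * f + 1) + suc (i + i)                ∎)
    where
    f : ℕ
    f = frobenius i
    regroup : ∀ f i → (f + suc i) + (f + suc i) ≡ (2 * f + 1) + suc (i + i)
    regroup = solve-∀

  frobenius<⇔ : ∀ {i t} → i < p i → frobenius i < t ⇔ p i ≤ t + i
  frobenius<⇔ {i} {t} dᵢ = mk⇔
    (λ f<t → subst (_≤ t + i) pᵢ≡ (+-monoˡ-≤ i f<t))
    (λ pᵢ≤ → +-cancelʳ-≤ i _ _ (subst (_≤ t + i) (sym pᵢ≡) pᵢ≤))
    where
    pᵢ≡ : suc (frobenius i) + i ≡ p i
    pᵢ≡ = trans (sym (+-suc _ i)) (m∸n+n≡m dᵢ)

  durfee-box : ∀ {i j} → i < p i → j < p j → j < p i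
  durfee-box {i} {j} dᵢ dⱼ with i ≤? j
  ... | yes i≤j = <-≤-trans dⱼ (part-antitone i≤j)
  ... | no  i≰j = <-trans (≰⇒> i≰j) dᵢ

  durfee-hook-average : ∀ {i j} → i < p i → j < p j → hook L i j + hook L i j ≡ hook L i i + hook L j j
  durfee-hook-average {i} {j} dᵢ dⱼ = +-cancelʳ-≡ (suc (i + i) + suc (j + j)) _ _ (begin-equality
    (h + h) + (suc (i + i) + suc (j + j))                    ≡⟨ regroup h i j ⟩
    (h + suc (i + j)) + (h + suc (i + j))                    ≡⟨ cong₂ _+_ hᵢⱼ+ hᵢⱼ+ ⟩
    (p i + p j) + (p i + p j)                                ≡⟨ +-interchange (p i) (p j) (p i) (p j) ⟩
    (p i + p i) + (p j + p j)                                ≡⟨ sym (cong₂ _+_ (hook-formula dᵢ) (hook-formula dⱼ)) ⟩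
    (hook L i i + suc (i + i)) + (hook L j j + suc (j + j))  ≡⟨ +-interchange (hook L i i) _ (hook L j j) _ ⟩
    (hook L i i + hook L j j) + (suc (i + i) + suc (j + j))  ∎)
    where
    h : ℕ
    h = hook L i j
    hᵢⱼ+ : h + suc (i + j) ≡ p i + p j
    hᵢⱼ+ = hook-formula (durfee-box dᵢ dⱼ)
    regroup : ∀ h i j → (h + h) + (suc (i + i) + suc (j + j)) ≡ (h + suc (i + j)) + (h + suc (i + j))
    regroup = solve-∀

  hook< : ∀ {i j A B} → j < p i → p i ≤ A + i → p j ≤ B + j → hook L i j < A + B
  hook< {i} {j} {A} {B} j<pᵢ pᵢ≤ pⱼ≤ = +-cancelʳ-≤ (i + j) _ _ (begin
    suc (hook L i j) + (i + j)   ≡⟨ sym (+-suc _ (i + j)) ⟩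
    hook L i j + suc (i + j)     ≡⟨ hook-formula j<pᵢ ⟩
    p i + p j                    ≤⟨ +-mono-≤ pᵢ≤ pⱼ≤ ⟩
    (A + i) + (B + j)            ≡⟨ +-interchange A i B j ⟩
    (A + B) + (i + j)            ∎)

  diagonal-hook-gap : ∀ {i j} → i < j → j < p j → p j < p i → 4 + hook L j j ≤ hook L i i
  diagonal-hook-gap {i} {j} i<j dⱼ pⱼ<pᵢ = +-cancelʳ-≤ (suc (i + i)) _ _ (begin
    4 + hook L j j + suc (i + i)            ≡⟨ cong (2 +_) (sym (suc-double-shift (hook L j j) i)) ⟩
    2 + (hook L j j + suc (suc i + suc i))  ≤⟨ +-monoʳ-≤ (2 + hook L j j) (s≤s (+-mono-≤ i<j i<j)) ⟩
    2 + (hook L j j + suc (j + j))          ≡⟨ cong (2 +_) (hook-formula dⱼ) ⟩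
    2 + (p j + p j)                         ≡⟨ cong suc (sym (+-suc (p j) (p j))) ⟩
    suc (p j) + suc (p j)                   ≤⟨ +-mono-≤ pⱼ<pᵢ pⱼ<pᵢ ⟩
    p i + p i                               ≡⟨ sym (hook-formula (<-trans i<j (<-trans dⱼ pⱼ<pᵢ))) ⟩
    hook L i i + suc (i + i)                ∎)

  frobenius-odd∈MD : ∀ {k} → k < p k → 2 * frobenius k + 1 ∈ MD L
  frobenius-odd∈MD dₖ = subst (_∈ MD L) (hook-diagonal dₖ) (∈MD⁺ dₖ)

  crossing : ∀ n → ∃[ j ] j ≤ n + p j × n + p (suc j) ≤ j
  crossing n
    with boundary (λ j → j ≤? n + p j) z≤n (suc (n + p 0)) (<⇒≱ (s≤s (+-monoʳ-≤ n (part-antitone z≤n))))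
  ... | j , j≤n+pⱼ , 1+j≰ = j , j≤n+pⱼ , s≤s⁻¹ (≰⇒> 1+j≰)

  -- At the crossing j, equality j ≡ n + p j puts a first-row hook at p 0 ∸ suc n, while
  -- strict inequality makes row k = j ∸ n a diagonal row with p k ≡ suc (n + k).
  first-row-hook⊎odd∈MD : ∀ {n} → n < p 0 →
    (∃[ j ] j < p 0 × hook L 0 j + suc n ≡ p 0) ⊎ 2 * n + 1 ∈ MD L
  first-row-hook⊎odd∈MD {n} n<p₀ with crossing n
  ... | j , j≤n+pⱼ , n+pⱼ₊₁≤j with m≤n⇒m<n∨m≡n j≤n+pⱼ
  ...   | inj₂ j≡n+pⱼ = inj₁ (j , j<p₀ , +-cancelʳ-≡ (p j) _ _ (begin-equality
          hook L 0 j + suc n + p j    ≡⟨ +-assoc (hook L 0 j) (suc n) (p j) ⟩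
          hook L 0 j + suc (n + p j)  ≡⟨ cong (λ m → hook L 0 j + suc m) (sym j≡n+pⱼ) ⟩
          hook L 0 j + suc j          ≡⟨ hook-formula j<p₀ ⟩
          p 0 + p j                   ∎))
    where
    j<p₀ : j < p 0
    j<p₀ with 0 <? p j
    ... | yes 0<pⱼ = transpose 0<pⱼ
    ... | no  0≮pⱼ = subst (_< p 0) (sym j≡n) n<p₀
      where
      j≡n : j ≡ n
      j≡n = trans j≡n+pⱼ (trans (cong (n +_) (n≤0⇒n≡0 (≮⇒≥ 0≮pⱼ))) (+-identityʳ n))
  ...   | inj₁ j<n+pⱼ with m≤n⇒∃[o]m+o≡n (≤-trans (m≤m+n n _) n+pⱼ₊₁≤j)
  ...     | k , refl = inj₂ (subst (λ a → 2 * a + 1 ∈ MD L) frobeniusₖ≡n (frobenius-odd∈MD dₖ))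
    where
    n+k<pₖ : n + k < p k
    n+k<pₖ = transpose (+-cancelˡ-< n k (p (n + k)) j<n+pⱼ)
    pₖ≤1+n+k : p k ≤ suc (n + k)
    pₖ≤1+n+k = ≮⇒≥ λ 1+n+k<pₖ → <⇒≱ (transpose 1+n+k<pₖ) (+-cancelˡ-≤ n _ _ n+pⱼ₊₁≤j)
    dₖ : k < p k
    dₖ = ≤-<-trans (m≤n+m k n) n+k<pₖ
    frobeniusₖ≡n : frobenius k ≡ n
    frobeniusₖ≡n = trans (cong (_∸ suc k) (≤-antisym pₖ≤1+n+k n+k<pₖ)) (m+n∸n≡m n k)

  distinct⇒part-< : FirstPartsDistinct L → ∀ {i j} → i < j → j < p j → p j < p i
  distinct⇒part-< distinct {i} {j} i<j dⱼ =
    ≤∧≢⇒< (part-antitone (<⇒≤ i<j)) (λ pⱼ≡pᵢ → distinct i j i<j (from <sOf⇔ dⱼ) (sym pⱼ≡pᵢ))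

  distinct⇒condII : FirstPartsDistinct L → CondII L
  distinct⇒condII distinct h₁ h₂ h₁∈ h₂∈ h₂<h₁ with ∈MD⁻ h₁∈ | ∈MD⁻ h₂∈
  ... | i , dᵢ , refl | j , dⱼ , refl with <-cmp i j
  ... | tri< i<j _ _ = m+n≤o⇒m≤o∸n 4 (diagonal-hook-gap i<j dⱼ (distinct⇒part-< distinct i<j dⱼ))
  ... | tri≈ _ refl _ = contradiction h₂<h₁ (<-irrefl refl)
  ... | tri> _ _ j<i = contradiction h₂<h₁
        (<-asym (≤-trans (s≤s (m≤n+m _ 3)) (diagonal-hook-gap j<i dᵢ (distinct⇒part-< distinct j<i dᵢ))))

  condII⇒distinct : CondII L → FirstPartsDistinct L
  condII⇒distinct condII i j i<j j<s pᵢ≡pⱼ =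
    condII⇒¬2+h∈MD L condII (∈MD⁺ dᵢ₊₁) (subst (_∈ MD L) hᵢ≡2+h′ (∈MD⁺ dᵢ))
    where
    dⱼ : j < p j
    dⱼ = to <sOf⇔ j<s
    pᵢ₊₁≡pᵢ : p (suc i) ≡ p i
    pᵢ₊₁≡pᵢ = ≤-antisym (part-antitone (n≤1+n i)) (subst (_≤ p (suc i)) (sym pᵢ≡pⱼ) (part-antitone i<j))
    dᵢ₊₁ : suc i < p (suc i)
    dᵢ₊₁ = <-≤-trans (≤-<-trans i<j dⱼ) (part-antitone i<j)
    dᵢ : i < p i
    dᵢ = <-≤-trans (<-trans (n<1+n i) dᵢ₊₁) (≤-reflexive pᵢ₊₁≡pᵢ)
    h′ : ℕ
    h′ = hook L (suc i) (suc i)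
    hᵢ≡2+h′ : hook L i i ≡ 2 + h′
    hᵢ≡2+h′ = +-cancelʳ-≡ (suc (i + i)) _ _ (begin-equality
      hook L i i + suc (i + i)      ≡⟨ hook-formula dᵢ ⟩
      p i + p i                     ≡⟨ sym (cong₂ _+_ pᵢ₊₁≡pᵢ pᵢ₊₁≡pᵢ) ⟩
      p (suc i) + p (suc i)         ≡⟨ sym (hook-formula dᵢ₊₁) ⟩
      h′ + suc (suc i + suc i)      ≡⟨ suc-double-shift h′ i ⟩
      2 + h′ + suc (i + i)          ∎)

  cores⇒condIII : ∀ {t} → IsCore t L → IsCore (suc t) L → CondIII t L
  cores⇒condIII {t} core core₁ h₁ h₂ h₁∈ h₂∈ with ∈MD⁻ h₁∈ | ∈MD⁻ h₂∈
  ... | i , dᵢ , refl | j , dⱼ , refl =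
      (λ sum≡2t → core⇒hook≢ L core box (m+m≡2*n⇒m≡n (trans double sum≡2t)))
    , (λ sum≡2t+2 → core⇒hook≢ L core₁ box (m+m≡2*n⇒m≡n (trans double (trans sum≡2t+2 (2*t+2≡2*[1+t] t)))))
    where
    box : j < p i
    box = durfee-box dᵢ dⱼ
    double : hook L i j + hook L i j ≡ hook L i i + hook L j j
    double = durfee-hook-average dᵢ dⱼ
    2*t+2≡2*[1+t] : ∀ t → 2 * t + 2 ≡ 2 * suc t
    2*t+2≡2*[1+t] = solve-∀

  module _ {t} (core : IsCore t L) (core₁ : IsCore (suc t) L) where

    part₀≢1+t : suc t ≢ p 0
    part₀≢1+t 1+t≡p₀ with first-row-hook⊎odd∈MD (subst (0 <_) 1+t≡p₀ z<s)
    ... | inj₁ (j , j<p₀ , h+1≡p₀) =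
      core⇒hook≢ L core j<p₀ (+-cancelʳ-≡ 1 _ t (trans h+1≡p₀ (trans (sym 1+t≡p₀) (+-comm 1 t))))
    ... | inj₂ 1∈MD = proj₂ (cores⇒condIII core core₁ _ _ 2t+1∈MD 1∈MD) (+-assoc (2 * t) 1 1)
      where
      2t+1∈MD : 2 * t + 1 ∈ MD L
      2t+1∈MD = subst (λ m → 2 * (m ∸ 1) + 1 ∈ MD L) (sym 1+t≡p₀)
                      (frobenius-odd∈MD (subst (0 <_) 1+t≡p₀ z<s))

    2+t≰part₀ : CondII L → ¬ 2 + t ≤ p 0
    2+t≰part₀ condII 2+t≤p₀ with m≤n⇒∃[o]m+o≡n 2+t≤p₀
    ... | o , 2+t+o≡p₀
        with first-row-hook⊎odd∈MD (<-≤-trans (s≤s (s≤s (m≤n+m o t))) (≤-reflexive 2+t+o≡p₀))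
           | first-row-hook⊎odd∈MD (<-≤-trans (s≤s (m≤n+m o (suc t))) (≤-reflexive 2+t+o≡p₀))
    ... | inj₁ (j , j<p₀ , h≡) | _ = core⇒hook≢ L core j<p₀ (+-cancelʳ-≡ (2 + o) _ t (begin-equality
          hook L 0 j + suc (suc o)  ≡⟨ h≡ ⟩
          p 0                       ≡⟨ sym 2+t+o≡p₀ ⟩
          2 + (t + o)               ≡⟨ cong suc (sym (+-suc t o)) ⟩
          suc (t + suc o)           ≡⟨ sym (+-suc t (suc o)) ⟩
          t + (2 + o)               ∎))
    ... | inj₂ _ | inj₁ (j , j<p₀ , h≡) = core⇒hook≢ L core₁ j<p₀ (+-cancelʳ-≡ (suc o) _ (suc t)
          (trans h≡ (trans (sym 2+t+o≡p₀) (cong suc (sym (+-suc t o))))))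
    ... | inj₂ odd₁₊ₒ | inj₂ oddₒ = condII⇒¬2+h∈MD L condII oddₒ (subst (_∈ MD L) (cong (_+ 1) (*-suc 2 o)) odd₁₊ₒ)

    part₀≤ : CondII L → p 0 ≤ t
    part₀≤ condII = ≮⇒≥ λ t<p₀ → [ 2+t≰part₀ condII , part₀≢1+t ]′ (m≤n⇒m<n∨m≡n t<p₀)

    cores⇒condI : CondII L → CondI t L
    cores⇒condI condII h h∈ with ∈MD⁻ h∈
    ... | i , dᵢ , refl = (frobenius i , frobenius<t , hook-diagonal dᵢ)
                        , core⇒hook≢ L core dᵢ , core⇒hook≢ L core₁ dᵢ
      where
      frobenius<t : frobenius i < t
      frobenius<t = from (frobenius<⇔ dᵢ) (≤-trans (part-antitone z≤n) (≤-trans (part₀≤ condII) (m≤m+n t i)))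

  module _ {t} (condI : CondI t L) (condIII : CondIII t L) where

    durfee-part-bound : ∀ {i} → i < p i → p i ≤ t + i
    durfee-part-bound {i} dᵢ with proj₁ (condI _ (∈MD⁺ dᵢ))
    ... | k , k<t , hᵢ≡2k+1 = to (frobenius<⇔ dᵢ) (subst (_< t) (sym frobeniusᵢ≡k) k<t)
      where
      frobeniusᵢ≡k : frobenius i ≡ k
      frobeniusᵢ≡k = *-cancelˡ-≡ _ k 2 (+-cancelʳ-≡ 1 _ _ (trans (sym (hook-diagonal dᵢ)) hᵢ≡2k+1))

    durfee⊎hook<t : ∀ {i j} → j < p i → (i < p i × j < p j) ⊎ hook L i j < t
    durfee⊎hook<t {i} {j} j<pᵢ with i <? p i | j <? p j
    ... | yes dᵢ | yes dⱼ = inj₁ (dᵢ , dⱼ)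
    ... | yes dᵢ | no ¬dⱼ =
      inj₂ (subst (hook L i j <_) (+-identityʳ t) (hook< j<pᵢ (durfee-part-bound dᵢ) (≮⇒≥ ¬dⱼ)))
    ... | no ¬dᵢ | yes dⱼ = inj₂ (hook< j<pᵢ (≮⇒≥ ¬dᵢ) (durfee-part-bound dⱼ))
    ... | no ¬dᵢ | no ¬dⱼ =
      contradiction (<-≤-trans (transpose j<pᵢ) (≮⇒≥ ¬dⱼ)) (<-asym (<-≤-trans j<pᵢ (≮⇒≥ ¬dᵢ)))

    hook<2t : ∀ {i j} → j < p i → hook L i j < t + t
    hook<2t j<pᵢ with durfee⊎hook<t j<pᵢ
    ... | inj₁ (dᵢ , dⱼ) = hook< j<pᵢ (durfee-part-bound dᵢ) (durfee-part-bound dⱼ)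
    ... | inj₂ h<t       = <-≤-trans h<t (m≤m+n t t)

    hook≢t : ∀ {i j} → j < p i → hook L i j ≢ t
    hook≢t {i} {j} j<pᵢ with durfee⊎hook<t j<pᵢ
    ... | inj₁ (dᵢ , dⱼ) = λ h≡t → proj₁ (condIII _ _ (∈MD⁺ dᵢ) (∈MD⁺ dⱼ)) (begin-equality
          hook L i i + hook L j j  ≡⟨ sym (durfee-hook-average dᵢ dⱼ) ⟩
          hook L i j + hook L i j  ≡⟨ cong₂ _+_ h≡t h≡t ⟩
          t + t                    ≡⟨ cong (t +_) (sym (+-identityʳ t)) ⟩
          2 * t                    ∎)
    ... | inj₂ h<t       = <⇒≢ h<t

    hook≢1+t : ∀ {i j} → j < p i → hook L i j ≢ suc t
    hook≢1+t {i} {j} j<pᵢ with durfee⊎hook<t j<pᵢ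
    ... | inj₁ (dᵢ , dⱼ) = λ h≡1+t → proj₂ (condIII _ _ (∈MD⁺ dᵢ) (∈MD⁺ dⱼ)) (begin-equality
          hook L i i + hook L j j  ≡⟨ sym (durfee-hook-average dᵢ dⱼ) ⟩
          hook L i j + hook L i j  ≡⟨ cong₂ _+_ h≡1+t h≡1+t ⟩
          suc t + suc t            ≡⟨ [1+t]+[1+t]≡2*t+2 t ⟩
          2 * t + 2                ∎)
      where
      [1+t]+[1+t]≡2*t+2 : ∀ t → suc t + suc t ≡ 2 * t + 2
      [1+t]+[1+t]≡2*t+2 = solve-∀
    ... | inj₂ h<t       = <⇒≢ (m<n⇒m<1+n h<t)

    condI∧III⇒core : IsCore t L
    condI∧III⇒core = small-hooks⇒core L hook<2t hook≢t

    condI∧III⇒core₁ : IsCore (suc t) L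
    condI∧III⇒core₁ = small-hooks⇒core L (λ b → <-≤-trans (hook<2t b) (+-mono-≤ (n≤1+n t) (n≤1+n t))) hook≢1+t

theorem2p4 : (t : ℕ) → 0 < t → (λ′ : List ℕ) → IsPartition λ′ → SelfConjugate λ′ →
    (InDS t λ′ ⇔ (CondI t λ′ × CondII λ′ × CondIII t λ′))
theorem2p4 t _ L isPartition sc = mk⇔
  (λ (_ , _ , core , core₁ , distinct) → let condII = distinct⇒condII distinct in
     cores⇒condI core core₁ condII , condII , cores⇒condIII core core₁)
  (λ (condI , condII , condIII) →
     isPartition , sc , condI∧III⇒core condI condIII , condI∧III⇒core₁ condI condIII , condII⇒distinct condII)
  where open SelfConjugateDiagram L sc
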